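{- Let $(A,+)$, $(B,+)$ be finite abelian groups, $n=|A|$, $k\ge 2$ an integer, and let $f:A\to B$ be a surjective zero-difference balanced function for which there is $b_0\in B$ with $|f^{ -1}(b_0)|=1$ and $|f^{ -1}(b)|=k$ for all $b\neq b_0$. Let $a_0$ be the element with $f(a_0)=b_0$, let $a\in A$ with $a_0\notin I(a)$, where $I(a)=\{x\in A\mid f(x)=f(a)\}$, and define $g_a(x)=f(x)$ for $x\neq a_0$ and $g_a(a_0)=f(a)$. Then $g_a$ is an $(n,\frac{n-1}{k},S)$ zero-difference function for some set $S$; suppose $\max_{x\in S}x=k$. Let $g_a(A)=\{c_0,\ldots,c_{m-1}\}$ with $m=\frac{n-1}{k}$, $D_i=\{x\in A\mid g_a(x)=c_i\}$, $w_i=|D_i|$. Then $\mathcal{D}=\{D_0,\ldots,D_{m-1}\}$ is an optimal $(n,[w_0,\ldots,w_{m-1}],n-k)$ difference system of sets. Moreover, it is perfect if $g_a$ is a zero-difference balanced function.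
   Context: For $h:A\to B$ with $n=|A|$, $m=|h(A)|$, $\lambda_\alpha=|\{x\in A\mid h(x+\alpha)=h(x)\}|$ for $\alpha\neq0$: $h$ is an $(n,m,S)$ zero-difference function if $S=\{\lambda_\alpha\mid\alpha\in A\setminus\{0\}\}$, and zero-difference balanced if $S$ is a single value. Disjoint subsets $D_0,\ldots,D_{q-1}$ of an abelian group $G$ of order $n$ with $|D_i|=w_i$ form an $(n,[w_0,\ldots,w_{q-1}],\rho)$ difference system of sets (DSS) if the multiset $\{x-y\mid x\in D_i,\ y\in D_j,\ i\neq j\}$ contains every nonzero element of $G$ at least $\rho$ times; it is perfect if every nonzero element appears exactly $\rho$ times. With $\tau=\sum_i|D_i|$ and $q\ge 2$, $\tau\ge\sqrt{\mathrm{SQUARE}(\rho(n-1)+\lceil\frac{\rho(n-1)}{q-1}\rceil)}$, where $\mathrm{SQUARE}(x)$ is the smallest perfect square not less than $x$; the DSS is optimal if equality holds. -}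

module Defs where

open import Data.Nat using (ℕ; _*_; _∸_; _≤_) renaming (_+_ to _+ℕ_)
open import Data.Empty using (⊥)
open import Data.Fin using (Fin; _≟_)
open import Data.Fin.Properties using (any?)
open import Data.List using (List; map; allFin)
open import Data.Nat.ListAction using (sum)
open import Data.Bool using (Bool; true; false; if_then_else_; _∧_; not)
open import Data.Product using (Σ; ∃; _×_; _,_)
open import Relation.Nullary using (¬_)
open import Relation.Nullary.Decidable using (⌊_⌋)
open import Relation.Binary.PropositionalEquality using (_≡_; _≢_)
open import Algebra.Structures using (IsAbelianGroup)

record FinAbGroup (n : ℕ) : Set where
  field
    _+_ : Fin n → Fin n → Fin n
    0#  : Fin n
    -_  : Fin n → Fin n
    isAbelianGroup : IsAbelianGroup _≡_ _+_ 0# -_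
  infixl 6 _+_
  infix 8 -_
  _-_ : Fin n → Fin n → Fin n
  x - y = x + (- y)
  infixl 6 _-_

sumF : ∀ {n} → (Fin n → ℕ) → ℕ
sumF {n} f = sum (map f (allFin n))

count : ∀ {n} → (Fin n → Bool) → ℕ
count p = sumF (λ x → if p x then 1 else 0)

fiberSize : ∀ {n nB} → (Fin n → Fin nB) → Fin nB → ℕ
fiberSize h b = count (λ x → ⌊ h x ≟ b ⌋)

imageSize : ∀ {n nB} → (Fin n → Fin nB) → ℕ
imageSize h = count (λ b → ⌊ any? (λ x → h x ≟ b) ⌋)

lam : ∀ {n nB} → FinAbGroup n → (Fin n → Fin nB) → Fin n → ℕ
lam G h α = count (λ x → ⌊ h (x + α) ≟ h x ⌋)
  where open FinAbGroup G

InS : ∀ {n nB} → FinAbGroup n → (Fin n → Fin nB) → ℕ → Set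
InS {n} G h s = Σ (Fin n) λ α → (α ≢ FinAbGroup.0# G) × (lam G h α ≡ s)

MaxSIs : ∀ {n nB} → FinAbGroup n → (Fin n → Fin nB) → ℕ → Set
MaxSIs G h k = InS G h k × (∀ s → InS G h s → s ≤ k)

ZDB : ∀ {n nB} → FinAbGroup n → (Fin n → Fin nB) → Set
ZDB G h = ∃ λ s → ∀ s' → InS G h s' → s' ≡ s

Surjective : ∀ {n nB} → (Fin n → Fin nB) → Set
Surjective {n} {nB} h = ∀ (b : Fin nB) → ∃ λ (x : Fin n) → h x ≡ b

gFun : ∀ {n nB} → (Fin n → Fin nB) → Fin n → Fin n → Fin n → Fin nB
gFun f a0 a x = if ⌊ x ≟ a0 ⌋ then f a else f x

Family : ℕ → ℕ → Set
Family q n = Fin q → Fin n → Bool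

Disjoint : ∀ {q n} → Family q n → Set
Disjoint D = ∀ i j x → i ≢ j → D i x ≡ true → D j x ≡ true → ⊥

diffCount : ∀ {q n} → FinAbGroup n → Family q n → Fin n → ℕ
diffCount G D δ =
  sumF λ i → sumF λ j → sumF λ x → sumF λ y →
    if not ⌊ i ≟ j ⌋ ∧ D i x ∧ D j y ∧ ⌊ x - y ≟ δ ⌋ then 1 else 0
  where open FinAbGroup G

-- (n, [w_0,…,w_{q-1}], ρ) DSS (the w_i are the sizes count (D i))
IsDSS : ∀ {q n} → FinAbGroup n → Family q n → ℕ → Set
IsDSS G D ρ = Disjoint D × (∀ δ → δ ≢ FinAbGroup.0# G → ρ ≤ diffCount G D δ)

IsPerfectDSS : ∀ {q n} → FinAbGroup n → Family q n → ℕ → Set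
IsPerfectDSS G D ρ = Disjoint D × (∀ δ → δ ≢ FinAbGroup.0# G → diffCount G D δ ≡ ρ)

tau : ∀ {q n} → Family q n → ℕ
tau D = sumF λ i → count (D i)

IsCeilDiv : ℕ → ℕ → ℕ → Set
IsCeilDiv a b c = (a ≤ c * b) × (∀ c' → a ≤ c' * b → c ≤ c')

IsSQUARE : ℕ → ℕ → Set
IsSQUARE x s = (∃ λ t → s ≡ t * t) × (x ≤ s) × (∀ t → x ≤ t * t → s ≤ t * t)

-- optimal: τ = sqrt(SQUARE(ρ(n-1) + ⌈ρ(n-1)/(q-1)⌉)), i.e. τ² = SQUARE(…)
IsOptimalDSS : ∀ {q n} → FinAbGroup n → Family q n → ℕ → Set
IsOptimalDSS {q} {n} G D ρ =
  IsDSS G D ρ ×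
  (∃ λ c → IsCeilDiv (ρ * (n ∸ 1)) (q ∸ 1) c ×
           IsSQUARE (ρ * (n ∸ 1) +ℕ c) (tau D * tau D))

-- Moving a₀ into the fibre of f(a) empties the fibre of b₀ and leaves every other fibre of size k,
-- except that of f(a), which gains a₀; counting fibres gives n = 1 + k·|g(A)| and, for the
-- enumeration c of the m classes, n = 1 + mk.  For δ ≠ 0 each pair (y + δ, y) is counted either in
-- the difference multiset of the classes (if g separates it) or in λ_δ(g) (if not), so δ occurs
-- n − λ_δ ≥ n − k times, with equality throughout when g is balanced.  The classes cover A, so
-- τ = n.  With K = mk and ρ = n − k = 1 + (m − 1)k, the ceiling ⌈ρK/(m − 1)⌉ lies in (Kk, Kk + K],
-- which puts ρK + ⌈ρK/(m − 1)⌉ strictly between K² and (K + 1)² = n².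

module Submission where

open import Defs
open import Algebra.Bundles using (AbelianGroup)
import Algebra.Properties.AbelianGroup
open import Data.Bool using (Bool; true; false; if_then_else_; _∧_; not)
open import Data.Bool.Properties using (∧-zeroʳ; ∧-identityʳ)
open import Data.Empty using (⊥-elim)
open import Data.Fin using (Fin; _≟_)
import Data.Fin as Fin
open import Data.Fin.Properties using (any?; punchInᵢ≢i)
import Data.List as List
open import Data.Nat
  using (ℕ; zero; suc; _+_; _*_; _∸_; _≤_; _<_; _≤?_; NonZero; >-nonZero; >-nonZero⁻¹; z≤n; z<s; s≤s; s≤s⁻¹)
open import Data.Nat.DivMod using (_/_; _%_; m≡m%n+[m/n]*n; m%n<n; m/n*n≤m)
open import Data.Nat.ListAction using () renaming (sum to sumᴸ)
open import Data.Nat.Properties hiding (_≟_)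
open import Data.Nat.Tactic.RingSolver using (solve-∀)
open import Data.Product using (∃; _×_; _,_; proj₁; proj₂)
open import Data.Vec.Functional using (removeAt)
open import Function using (_∘_; _⇔_; mk⇔; Equivalence)
open import Level using (0ℓ)
open import Relation.Nullary using (Dec; yes; no; ¬_)
open import Relation.Nullary.Decidable using (⌊_⌋; isYes≗does; dec-true; dec-false; does-⇔)
open import Relation.Binary.PropositionalEquality
  using (_≡_; _≢_; refl; sym; trans; cong; cong₂; subst; module ≡-Reasoning)
open import Algebra.Properties.Semiring.Sum +-*-semiring
  using (sum; sum-syntax; sum-cong-≗; sum-remove; sum-replicate-zero; ∑-comm; ∑-distrib-+; *-distribˡ-sum)

𝟙 : Bool → ℕ
𝟙 b = if b then 1 else 0

𝟙-not+𝟙 : ∀ b → 𝟙 (not b) + 𝟙 b ≡ 1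
𝟙-not+𝟙 true  = refl
𝟙-not+𝟙 false = refl

module _ {A : Set} where

  ⌊⌋-true : (a? : Dec A) → A → ⌊ a? ⌋ ≡ true
  ⌊⌋-true a? a = trans (isYes≗does a?) (dec-true a? a)

  ⌊⌋-false : (a? : Dec A) → ¬ A → ⌊ a? ⌋ ≡ false
  ⌊⌋-false a? ¬a = trans (isYes≗does a?) (dec-false a? ¬a)

  ⌊⌋≡true⇒ : (a? : Dec A) → ⌊ a? ⌋ ≡ true → A
  ⌊⌋≡true⇒ (yes a) _ = a

  ⌊⌋-⇔ : ∀ {B : Set} → A ⇔ B → (a? : Dec A) (b? : Dec B) → ⌊ a? ⌋ ≡ ⌊ b? ⌋
  ⌊⌋-⇔ A⇔B a? b? = trans (isYes≗does a?) (trans (does-⇔ A⇔B a? b?) (sym (isYes≗does b?)))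

sumᴸ-map-tabulate : ∀ {n} {A : Set} (f : A → ℕ) (g : Fin n → A) →
                    sumᴸ (List.map f (List.tabulate g)) ≡ sum (f ∘ g)
sumᴸ-map-tabulate {zero}  f g = refl
sumᴸ-map-tabulate {suc n} f g = cong (f (g Fin.zero) +_) (sumᴸ-map-tabulate f (g ∘ Fin.suc))

sumF≡sum : ∀ {n} (f : Fin n → ℕ) → sumF f ≡ sum f
sumF≡sum f = sumᴸ-map-tabulate f (λ x → x)

∑-const : ∀ n c → ∑[ i < n ] c ≡ n * c
∑-const zero    c = refl
∑-const (suc n) c = cong (c +_) (∑-const n c)

∑-1 : ∀ n → ∑[ i < n ] 1 ≡ n
∑-1 n = trans (∑-const n 1) (*-identityʳ n)

∑-mono-≤ : ∀ {n} {f g : Fin n → ℕ} → (∀ i → f i ≤ g i) → sum f ≤ sum g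
∑-mono-≤ {zero}  f≤g = z≤n
∑-mono-≤ {suc n} f≤g = +-mono-≤ (f≤g Fin.zero) (∑-mono-≤ (f≤g ∘ Fin.suc))

∑-concentrated : ∀ {n} (f : Fin n → ℕ) (a : Fin n) → (∀ x → x ≢ a → f x ≡ 0) → sum f ≡ f a
∑-concentrated {suc n} f a f≡0 = begin
  sum f                     ≡⟨ sum-remove {i = a} f ⟩
  f a + sum (removeAt f a)  ≡⟨ cong (f a +_) (trans (sum-cong-≗ (λ j → f≡0 _ (punchInᵢ≢i a j)))
                                                    (sum-replicate-zero n)) ⟩
  f a + 0                   ≡⟨ +-identityʳ (f a) ⟩
  f a                       ∎
  where open ≡-Reasoning

∑-𝟙-unique : ∀ {n} (p : Fin n → Bool) (a : Fin n) → p a ≡ true → (∀ x → p x ≡ true → x ≡ a) →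
             ∑[ x < n ] 𝟙 (p x) ≡ 1
∑-𝟙-unique p a pa unique = trans (∑-concentrated (𝟙 ∘ p) a vanish) (cong 𝟙 pa)
  where
  vanish : ∀ x → x ≢ a → 𝟙 (p x) ≡ 0
  vanish x x≢a with p x in px
  ... | true  = ⊥-elim (x≢a (unique x px))
  ... | false = refl

∑-𝟙-≟ : ∀ {n} (a : Fin n) → ∑[ x < n ] 𝟙 ⌊ x ≟ a ⌋ ≡ 1
∑-𝟙-≟ a = ∑-𝟙-unique (λ x → ⌊ x ≟ a ⌋) a (⌊⌋-true (a ≟ a) refl) (λ x → ⌊⌋≡true⇒ (x ≟ a))

count≡1⇒unique : ∀ {n} (p : Fin n → Bool) → count p ≡ 1 →
                 ∀ {x y} → p x ≡ true → p y ≡ true → x ≡ y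
count≡1⇒unique {n} p count≡1 {x} {y} px py with x ≟ y
... | yes x≡y = x≡y
... | no  x≢y = ⊥-elim (1+n≰n {1} (begin
  2                                              ≡⟨ cong₂ _+_ (∑-𝟙-≟ x) (∑-𝟙-≟ y) ⟨
  ∑[ z < n ] 𝟙 ⌊ z ≟ x ⌋ + ∑[ z < n ] 𝟙 ⌊ z ≟ y ⌋  ≡⟨ ∑-distrib-+ (λ z → 𝟙 ⌊ z ≟ x ⌋) (λ z → 𝟙 ⌊ z ≟ y ⌋) ⟨
  ∑[ z < n ] (𝟙 ⌊ z ≟ x ⌋ + 𝟙 ⌊ z ≟ y ⌋)          ≤⟨ ∑-mono-≤ two-points≤p ⟩
  ∑[ z < n ] 𝟙 (p z)                              ≡⟨ sumF≡sum (𝟙 ∘ p) ⟨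
  count p                                        ≡⟨ count≡1 ⟩
  1                                              ∎))
  where
  open ≤-Reasoning
  two-points≤p : ∀ z → 𝟙 ⌊ z ≟ x ⌋ + 𝟙 ⌊ z ≟ y ⌋ ≤ 𝟙 (p z)
  two-points≤p z with z ≟ x | z ≟ y
  ... | yes refl | yes refl = ⊥-elim (x≢y refl)
  ... | yes refl | no _     rewrite px = ≤-refl
  ... | no _     | yes refl rewrite py = ≤-refl
  ... | no _     | no _     = z≤n

abelianGroup : ∀ {n} → FinAbGroup n → AbelianGroup 0ℓ 0ℓ
abelianGroup G = record { isAbelianGroup = FinAbGroup.isAbelianGroup G }

lam-constant : ∀ {n nB} (G : FinAbGroup n) (h : Fin n → Fin nB) → (∀ x y → h x ≡ h y) →
               ∀ δ → lam G h δ ≡ n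
lam-constant {n} G h h-constant δ = begin
  lam G h δ                              ≡⟨ sumF≡sum (λ x → 𝟙 ⌊ h (x ⊕ δ) ≟ h x ⌋) ⟩
  ∑[ x < n ] 𝟙 ⌊ h (x ⊕ δ) ≟ h x ⌋     ≡⟨ sum-cong-≗ (λ x → cong 𝟙 (⌊⌋-true (h (x ⊕ δ) ≟ h x) (h-constant _ _))) ⟩
  ∑[ x < n ] 1                         ≡⟨ ∑-1 n ⟩
  n                                    ∎
  where
  open ≡-Reasoning
  open FinAbGroup G renaming (_+_ to _⊕_)

module Partition {n m nB} (h : Fin n → Fin nB) (c : Fin m → Fin nB)
  (c-injective : ∀ i j → c i ≡ c j → i ≡ j) (covers : ∀ x → ∃ λ i → h x ≡ c i) where

  D : Family m n
  D i x = ⌊ h x ≟ c i ⌋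

  class : Fin n → Fin m
  class x = proj₁ (covers x)

  D-class : ∀ x → D (class x) x ≡ true
  D-class x = ⌊⌋-true (h x ≟ c (class x)) (proj₂ (covers x))

  D⇒class : ∀ {i x} → D i x ≡ true → i ≡ class x
  D⇒class {i} {x} Dix = c-injective i (class x) (trans (sym (⌊⌋≡true⇒ (h x ≟ c i) Dix)) (proj₂ (covers x)))

  D-off : ∀ {i x} → i ≢ class x → D i x ≡ false
  D-off {i} {x} i≢class = ⌊⌋-false (h x ≟ c i) (i≢class ∘ D⇒class ∘ ⌊⌋-true (h x ≟ c i))

  class≡⇔ : ∀ {x y} → class x ≡ class y ⇔ h x ≡ h y
  class≡⇔ {x} {y} = mk⇔
    (λ eq → trans (proj₂ (covers x)) (trans (cong c eq) (sym (proj₂ (covers y)))))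
    (λ eq → c-injective _ _ (trans (sym (proj₂ (covers x))) (trans eq (proj₂ (covers y)))))

  D-disjoint : Disjoint D
  D-disjoint i j x i≢j Dix Djx = i≢j (trans (D⇒class Dix) (sym (D⇒class Djx)))

  ∑-D : ∀ x → ∑[ i < m ] 𝟙 (D i x) ≡ 1
  ∑-D x = ∑-𝟙-unique (λ i → D i x) (class x) (D-class x) (λ i → D⇒class)

  ∑-fiberSize : ∑[ i < m ] fiberSize h (c i) ≡ n
  ∑-fiberSize = begin
    ∑[ i < m ] fiberSize h (c i)          ≡⟨ sum-cong-≗ (λ i → sumF≡sum (λ x → 𝟙 (D i x))) ⟩
    ∑[ i < m ] ∑[ x < n ] 𝟙 (D i x)      ≡⟨ ∑-comm (λ i x → 𝟙 (D i x)) ⟩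
    ∑[ x < n ] ∑[ i < m ] 𝟙 (D i x)      ≡⟨ sum-cong-≗ ∑-D ⟩
    ∑[ x < n ] 1                         ≡⟨ ∑-1 n ⟩
    n                                    ∎
    where open ≡-Reasoning

  tau≡n : tau D ≡ n
  tau≡n = trans (sumF≡sum (λ i → count (D i))) ∑-fiberSize

  module _ (G : FinAbGroup n) where
    open FinAbGroup G using (-_) renaming (_+_ to _⊕_; _-_ to _⊖_)
    open Algebra.Properties.AbelianGroup (abelianGroup G) using (xyx⁻¹≈y; ∙-cancelʳ)

    crossPair : Fin n → Fin m → Fin m → Fin n → Fin n → Bool
    crossPair δ i j x y = not ⌊ i ≟ j ⌋ ∧ D i x ∧ D j y ∧ ⌊ x ⊖ y ≟ δ ⌋

    x⊖y≡δ⇒x≡y⊕δ : ∀ {x y δ} → x ⊖ y ≡ δ → x ≡ y ⊕ δ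
    x⊖y≡δ⇒x≡y⊕δ {x} {y} {δ} eq = ∙-cancelʳ (- y) x (y ⊕ δ) (trans eq (sym (xyx⁻¹≈y y δ)))

    ∑-crossPair : ∀ δ x y → ∑[ i < m ] ∑[ j < m ] 𝟙 (crossPair δ i j x y) ≡ 𝟙 (not ⌊ h x ≟ h y ⌋ ∧ ⌊ x ⊖ y ≟ δ ⌋)
    ∑-crossPair δ x y = begin
      ∑[ i < m ] ∑[ j < m ] 𝟙 (crossPair δ i j x y)
        ≡⟨ sum-cong-≗ (λ i → ∑-concentrated _ (class y) λ j j≢ → cong 𝟙 (y∉D j i j≢)) ⟩
      ∑[ i < m ] 𝟙 (crossPair δ i (class y) x y)
        ≡⟨ ∑-concentrated _ (class x) (λ i i≢ → cong 𝟙 (x∉D i i≢)) ⟩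
      𝟙 (crossPair δ (class x) (class y) x y)
        ≡⟨ cong 𝟙 crossPair-classes ⟩
      𝟙 (not ⌊ h x ≟ h y ⌋ ∧ ⌊ x ⊖ y ≟ δ ⌋)
        ∎
      where
      open ≡-Reasoning
      y∉D : ∀ j i → j ≢ class y → crossPair δ i j x y ≡ false
      y∉D j i j≢ rewrite D-off j≢ | ∧-zeroʳ (D i x) = ∧-zeroʳ (not ⌊ i ≟ j ⌋)
      x∉D : ∀ i → i ≢ class x → crossPair δ i (class y) x y ≡ false
      x∉D i i≢ rewrite D-off i≢ = ∧-zeroʳ (not ⌊ i ≟ class y ⌋)
      crossPair-classes : crossPair δ (class x) (class y) x y ≡ not ⌊ h x ≟ h y ⌋ ∧ ⌊ x ⊖ y ≟ δ ⌋
      crossPair-classes rewrite D-class x | D-class y =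
        cong (λ b → not b ∧ ⌊ x ⊖ y ≟ δ ⌋) (⌊⌋-⇔ class≡⇔ (class x ≟ class y) (h x ≟ h y))

    ∑-shift : ∀ δ y → ∑[ x < n ] 𝟙 (not ⌊ h x ≟ h y ⌋ ∧ ⌊ x ⊖ y ≟ δ ⌋) ≡ 𝟙 (not ⌊ h (y ⊕ δ) ≟ h y ⌋)
    ∑-shift δ y = trans (∑-concentrated _ (y ⊕ δ) off) (cong 𝟙 on)
      where
      off : ∀ x → x ≢ y ⊕ δ → 𝟙 (not ⌊ h x ≟ h y ⌋ ∧ ⌊ x ⊖ y ≟ δ ⌋) ≡ 0
      off x x≢ rewrite ⌊⌋-false (x ⊖ y ≟ δ) (x≢ ∘ x⊖y≡δ⇒x≡y⊕δ) | ∧-zeroʳ (not ⌊ h x ≟ h y ⌋) = refl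
      on : not ⌊ h (y ⊕ δ) ≟ h y ⌋ ∧ ⌊ (y ⊕ δ) ⊖ y ≟ δ ⌋ ≡ not ⌊ h (y ⊕ δ) ≟ h y ⌋
      on rewrite ⌊⌋-true ((y ⊕ δ) ⊖ y ≟ δ) (xyx⁻¹≈y y δ) = ∧-identityʳ _

    diffCount≡∑-separated : ∀ δ → diffCount G D δ ≡ ∑[ y < n ] 𝟙 (not ⌊ h (y ⊕ δ) ≟ h y ⌋)
    diffCount≡∑-separated δ = begin
      diffCount G D δ
        ≡⟨ trans (sumF≡sum λ i → sumF λ j → sumF λ x → sumF λ y → P i j x y) (sum-cong-≗ λ i →
           trans (sumF≡sum λ j → sumF λ x → sumF λ y → P i j x y) (sum-cong-≗ λ j →
           trans (sumF≡sum λ x → sumF λ y → P i j x y) (sum-cong-≗ λ x →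
           sumF≡sum (P i j x)))) ⟩
      ∑[ i < m ] ∑[ j < m ] ∑[ x < n ] ∑[ y < n ] P i j x y
        ≡⟨ sum-cong-≗ (λ i → ∑-comm λ j x → ∑[ y < n ] P i j x y) ⟩
      ∑[ i < m ] ∑[ x < n ] ∑[ j < m ] ∑[ y < n ] P i j x y
        ≡⟨ ∑-comm (λ i x → ∑[ j < m ] ∑[ y < n ] P i j x y) ⟩
      ∑[ x < n ] ∑[ i < m ] ∑[ j < m ] ∑[ y < n ] P i j x y
        ≡⟨ sum-cong-≗ (λ x → sum-cong-≗ λ i → ∑-comm λ j y → P i j x y) ⟩
      ∑[ x < n ] ∑[ i < m ] ∑[ y < n ] ∑[ j < m ] P i j x y
        ≡⟨ sum-cong-≗ (λ x → ∑-comm λ i y → ∑[ j < m ] P i j x y) ⟩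
      ∑[ x < n ] ∑[ y < n ] ∑[ i < m ] ∑[ j < m ] P i j x y
        ≡⟨ sum-cong-≗ (λ x → sum-cong-≗ (∑-crossPair δ x)) ⟩
      ∑[ x < n ] ∑[ y < n ] 𝟙 (not ⌊ h x ≟ h y ⌋ ∧ ⌊ x ⊖ y ≟ δ ⌋)
        ≡⟨ ∑-comm (λ x y → 𝟙 (not ⌊ h x ≟ h y ⌋ ∧ ⌊ x ⊖ y ≟ δ ⌋)) ⟩
      ∑[ y < n ] ∑[ x < n ] 𝟙 (not ⌊ h x ≟ h y ⌋ ∧ ⌊ x ⊖ y ≟ δ ⌋)
        ≡⟨ sum-cong-≗ (∑-shift δ) ⟩
      ∑[ y < n ] 𝟙 (not ⌊ h (y ⊕ δ) ≟ h y ⌋)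
        ∎
      where
      open ≡-Reasoning
      P : Fin m → Fin m → Fin n → Fin n → ℕ
      P i j x y = 𝟙 (crossPair δ i j x y)

    diffCount+lam≡n : ∀ δ → diffCount G D δ + lam G h δ ≡ n
    diffCount+lam≡n δ = begin
      diffCount G D δ + lam G h δ
        ≡⟨ cong₂ _+_ (diffCount≡∑-separated δ) (sumF≡sum (𝟙 ∘ same)) ⟩
      ∑[ y < n ] 𝟙 (not (same y)) + ∑[ y < n ] 𝟙 (same y)
        ≡⟨ ∑-distrib-+ (𝟙 ∘ not ∘ same) (𝟙 ∘ same) ⟨
      ∑[ y < n ] (𝟙 (not (same y)) + 𝟙 (same y))
        ≡⟨ sum-cong-≗ (𝟙-not+𝟙 ∘ same) ⟩
      ∑[ y < n ] 1
        ≡⟨ ∑-1 n ⟩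
      n ∎
      where
      open ≡-Reasoning
      same : Fin n → Bool
      same y = ⌊ h (y ⊕ δ) ≟ h y ⌋

module _ {n nB} (f : Fin n → Fin nB) (a0 a : Fin n) where

  gFun-a0 : gFun f a0 a a0 ≡ f a
  gFun-a0 = cong (λ b → if b then f a else f a0) (⌊⌋-true (a0 ≟ a0) refl)

  gFun-≢ : ∀ {x} → x ≢ a0 → gFun f a0 a x ≡ f x
  gFun-≢ {x} x≢a0 = cong (λ b → if b then f a else f x) (⌊⌋-false (x ≟ a0) x≢a0)

  fiberSize-gFun : ∀ b → f a0 ≢ b → fiberSize (gFun f a0 a) b ≡ fiberSize f b + 𝟙 ⌊ f a ≟ b ⌋
  fiberSize-gFun b fa0≢b = begin
    fiberSize (gFun f a0 a) b
      ≡⟨ sumF≡sum (λ x → 𝟙 ⌊ gFun f a0 a x ≟ b ⌋) ⟩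
    ∑[ x < n ] 𝟙 ⌊ gFun f a0 a x ≟ b ⌋
      ≡⟨ sum-cong-≗ split ⟩
    ∑[ x < n ] (𝟙 ⌊ f x ≟ b ⌋ + 𝟙 (⌊ x ≟ a0 ⌋ ∧ ⌊ f a ≟ b ⌋))
      ≡⟨ ∑-distrib-+ (λ x → 𝟙 ⌊ f x ≟ b ⌋) (λ x → 𝟙 (⌊ x ≟ a0 ⌋ ∧ ⌊ f a ≟ b ⌋)) ⟩
    ∑[ x < n ] 𝟙 ⌊ f x ≟ b ⌋ + ∑[ x < n ] 𝟙 (⌊ x ≟ a0 ⌋ ∧ ⌊ f a ≟ b ⌋)
      ≡⟨ cong₂ _+_ (sym (sumF≡sum (λ x → 𝟙 ⌊ f x ≟ b ⌋))) (∑-concentrated _ a0 off-a0) ⟩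
    fiberSize f b + 𝟙 (⌊ a0 ≟ a0 ⌋ ∧ ⌊ f a ≟ b ⌋)
      ≡⟨ cong (λ t → fiberSize f b + 𝟙 (t ∧ ⌊ f a ≟ b ⌋)) (⌊⌋-true (a0 ≟ a0) refl) ⟩
    fiberSize f b + 𝟙 ⌊ f a ≟ b ⌋
      ∎
    where
    open ≡-Reasoning
    split : ∀ x → 𝟙 ⌊ gFun f a0 a x ≟ b ⌋ ≡ 𝟙 ⌊ f x ≟ b ⌋ + 𝟙 (⌊ x ≟ a0 ⌋ ∧ ⌊ f a ≟ b ⌋)
    split x with x ≟ a0
    ... | yes refl rewrite ⌊⌋-false (f a0 ≟ b) fa0≢b = refl
    ... | no _     = sym (+-identityʳ _)
    off-a0 : ∀ x → x ≢ a0 → 𝟙 (⌊ x ≟ a0 ⌋ ∧ ⌊ f a ≟ b ⌋) ≡ 0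
    off-a0 x x≢a0 rewrite ⌊⌋-false (x ≟ a0) x≢a0 = refl

ceilDiv : ∀ a b .{{_ : NonZero b}} → ∃ (IsCeilDiv a b)
ceilDiv a b@(suc b-1) = c , a≤c*b , c-least
  where
  c r : ℕ
  c = (a + b-1) / b
  r = (a + b-1) % b
  a+b-1≡r+c*b : a + b-1 ≡ r + c * b
  a+b-1≡r+c*b = m≡m%n+[m/n]*n (a + b-1) b
  a≤c*b : a ≤ c * b
  a≤c*b = +-cancelʳ-≤ b-1 a (c * b) (begin
    a + b-1      ≡⟨ a+b-1≡r+c*b ⟩
    r + c * b    ≤⟨ +-monoˡ-≤ (c * b) (s≤s⁻¹ (m%n<n (a + b-1) b)) ⟩
    b-1 + c * b  ≡⟨ +-comm b-1 (c * b) ⟩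
    c * b + b-1  ∎)
    where open ≤-Reasoning
  c-least : ∀ c′ → a ≤ c′ * b → c ≤ c′
  c-least c′ a≤c′*b = s≤s⁻¹ (*-cancelʳ-< b c (suc c′) (begin-strict
    c * b         ≤⟨ m/n*n≤m (a + b-1) b ⟩
    a + b-1       ≤⟨ +-monoˡ-≤ b-1 a≤c′*b ⟩
    c′ * b + b-1  <⟨ +-monoʳ-< (c′ * b) (n<1+n b-1) ⟩
    c′ * b + b    ≡⟨ +-comm (c′ * b) b ⟩
    suc c′ * b    ∎))
    where open ≤-Reasoning

isSQUARE-between : ∀ {x} K → K * K < x → x ≤ suc K * suc K → IsSQUARE x (suc K * suc K)
isSQUARE-between {x} K K²<x x≤[1+K]² = (suc K , refl) , x≤[1+K]² , least
  where
  least : ∀ t → x ≤ t * t → suc K * suc K ≤ t * t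
  least t x≤t² with t ≤? K
  ... | yes t≤K = ⊥-elim (<-irrefl refl (<-≤-trans (≤-<-trans (*-mono-≤ t≤K t≤K) K²<x) x≤t²))
  ... | no t≰K  = *-mono-≤ (≰⇒> t≰K) (≰⇒> t≰K)

optimal-square : ∀ q k .{{_ : NonZero q}} .{{_ : NonZero k}} {c} →
  IsCeilDiv (suc (q * k) * (suc q * k)) q c →
  IsSQUARE (suc (q * k) * (suc q * k) + c) (suc (suc q * k) * suc (suc q * k))
optimal-square q k {c} (a≤c*q , c-least) = isSQUARE-between K K²<a+c a+c≤[1+K]²
  where
  K ρ : ℕ
  K = suc q * k
  ρ = suc (q * k)
  K>0 : 0 < K
  K>0 = >-nonZero⁻¹ K {{m*n≢0 (suc q) k}}
  -- The ring solver does not unfold K and ρ, so these identities are stated in expanded form.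
  ρK≡K+Kkq : ∀ q k → suc (q * k) * (suc q * k) ≡ suc q * k + suc q * k * k * q
  ρK≡K+Kkq = solve-∀
  ρK+Kk≡K+K² : ∀ q k → suc (q * k) * (suc q * k) + suc q * k * k ≡ suc q * k + suc q * k * (suc q * k)
  ρK+Kk≡K+K² = solve-∀
  [1+K]²≡ : ∀ q k → suc (suc (q * k) * (suc q * k) + (suc q * k * k + suc q * k)) ≡ suc (suc q * k) * suc (suc q * k)
  [1+K]²≡ = solve-∀
  Kk<c : K * k < c
  Kk<c = *-cancelʳ-< q (K * k) c (begin-strict
    K * k * q      <⟨ m<n+m (K * k * q) K>0 ⟩
    K + K * k * q  ≡⟨ ρK≡K+Kkq q k ⟨
    ρ * K          ≤⟨ a≤c*q ⟩
    c * q          ∎)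
    where open ≤-Reasoning
  c≤Kk+K : c ≤ K * k + K
  c≤Kk+K = c-least (K * k + K) (begin
    ρ * K              ≡⟨ ρK≡K+Kkq q k ⟩
    K + K * k * q      ≤⟨ +-monoˡ-≤ (K * k * q) (m≤m*n K q) ⟩
    K * q + K * k * q  ≡⟨ +-comm (K * q) (K * k * q) ⟩
    K * k * q + K * q  ≡⟨ *-distribʳ-+ q (K * k) K ⟨
    (K * k + K) * q    ∎)
    where open ≤-Reasoning
  K²<a+c : K * K < ρ * K + c
  K²<a+c = begin-strict
    K * K          <⟨ m<n+m (K * K) K>0 ⟩
    K + K * K      ≡⟨ ρK+Kk≡K+K² q k ⟨
    ρ * K + K * k  <⟨ +-monoʳ-< (ρ * K) Kk<c ⟩
    ρ * K + c      ∎
    where open ≤-Reasoning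
  a+c≤[1+K]² : ρ * K + c ≤ suc K * suc K
  a+c≤[1+K]² = begin
    ρ * K + c            ≤⟨ +-monoʳ-≤ (ρ * K) c≤Kk+K ⟩
    ρ * K + (K * k + K)  ≤⟨ n≤1+n _ ⟩
    suc (ρ * K + (K * k + K))  ≡⟨ [1+K]²≡ q k ⟩
    suc K * suc K        ∎
    where open ≤-Reasoning

optimal-parameters : ∀ {n} k m .{{_ : NonZero k}} → 2 ≤ m → n ≡ suc (m * k) →
  ∃ λ c → IsCeilDiv ((n ∸ k) * (n ∸ 1)) (m ∸ 1) c × IsSQUARE ((n ∸ k) * (n ∸ 1) + c) (n * n)
optimal-parameters k (suc q@(suc _)) (s≤s (s≤s z≤n)) refl =
  subst (λ ρ → ∃ λ c → IsCeilDiv (ρ * K) q c × IsSQUARE (ρ * K + c) (suc K * suc K)) (sym n∸k≡ρ)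
        (let c , isCeil = ceilDiv (suc (q * k) * K) q in c , isCeil , optimal-square q k isCeil)
  where
  K : ℕ
  K = suc q * k
  n∸k≡ρ : suc K ∸ k ≡ suc (q * k)
  n∸k≡ρ = trans (cong (_∸ k) (sym (+-suc k (q * k)))) (m+n∸m≡n k (suc (q * k)))

m≢1⇒2≤m : ∀ {m} → Fin m → m ≢ 1 → 2 ≤ m
m≢1⇒2≤m {suc zero}    _ m≢1 = ⊥-elim (m≢1 refl)
m≢1⇒2≤m {suc (suc _)} _ _   = s≤s (s≤s z≤n)

Fin1-trivial : ∀ {m} → m ≡ 1 → (i j : Fin m) → i ≡ j
Fin1-trivial refl Fin.zero Fin.zero = refl

module ModifiedFunction {n nB} (GA : FinAbGroup n) (k : ℕ) .{{_ : NonZero k}}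
  (f : Fin n → Fin nB) (f-surjective : Surjective f)
  (b0 : Fin nB) (fiber-b0 : fiberSize f b0 ≡ 1) (fiber-k : ∀ b → b ≢ b0 → fiberSize f b ≡ k)
  (a0 : Fin n) (fa0≡b0 : f a0 ≡ b0) (a : Fin n) (fa0≢fa : f a0 ≢ f a) where

  open FinAbGroup GA using (0#)

  g : Fin n → Fin nB
  g = gFun f a0 a

  a≢a0 : a ≢ a0
  a≢a0 a≡a0 = fa0≢fa (cong f (sym a≡a0))

  f≡b0⇒a0 : ∀ {x} → f x ≡ b0 → x ≡ a0
  f≡b0⇒a0 {x} fx≡b0 =
    count≡1⇒unique (λ y → ⌊ f y ≟ b0 ⌋) fiber-b0 (⌊⌋-true (f x ≟ b0) fx≡b0) (⌊⌋-true (f a0 ≟ b0) fa0≡b0)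

  g≢b0 : ∀ x → g x ≢ b0
  g≢b0 x = by-cases (x ≟ a0)
    where
    by-cases : Dec (x ≡ a0) → g x ≢ b0
    by-cases (yes refl)  ga0≡b0 = fa0≢fa (trans fa0≡b0 (trans (sym ga0≡b0) (gFun-a0 f a0 a)))
    by-cases (no x≢a0) gx≡b0  = x≢a0 (f≡b0⇒a0 (trans (sym (gFun-≢ f a0 a x≢a0)) gx≡b0))

  g-hits : ∀ b → b ≢ b0 → ∃ λ x → g x ≡ b
  g-hits b b≢b0 with f-surjective b
  ... | x , fx≡b = x , trans (gFun-≢ f a0 a x≢a0) fx≡b
    where
    x≢a0 : x ≢ a0
    x≢a0 x≡a0 = b≢b0 (trans (sym fx≡b) (trans (cong f x≡a0) fa0≡b0))

  imageSize-g : imageSize g ≡ ∑[ b < nB ] 𝟙 (not ⌊ b ≟ b0 ⌋)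
  imageSize-g = trans (sumF≡sum (λ b → 𝟙 ⌊ any? (λ x → g x ≟ b) ⌋)) (sum-cong-≗ (cong 𝟙 ∘ hit⇔≢b0))
    where
    hit⇔≢b0 : ∀ b → ⌊ any? (λ x → g x ≟ b) ⌋ ≡ not ⌊ b ≟ b0 ⌋
    hit⇔≢b0 b with b ≟ b0
    ... | yes refl  = ⌊⌋-false (any? (λ x → g x ≟ b0)) (λ (x , gx≡b0) → g≢b0 x gx≡b0)
    ... | no b≢b0 = ⌊⌋-true (any? (λ x → g x ≟ b)) (g-hits b b≢b0)

  n≡1+k*|B∖b0| : n ≡ suc (k * ∑[ b < nB ] 𝟙 (not ⌊ b ≟ b0 ⌋))
  n≡1+k*|B∖b0| = begin
    n
      ≡⟨ Partition.∑-fiberSize f (λ b → b) (λ _ _ eq → eq) (λ x → f x , refl) ⟨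
    ∑[ b < nB ] fiberSize f b
      ≡⟨ sum-cong-≗ fiberSize-f ⟩
    ∑[ b < nB ] (𝟙 ⌊ b ≟ b0 ⌋ + k * 𝟙 (not ⌊ b ≟ b0 ⌋))
      ≡⟨ ∑-distrib-+ (λ b → 𝟙 ⌊ b ≟ b0 ⌋) (λ b → k * 𝟙 (not ⌊ b ≟ b0 ⌋)) ⟩
    ∑[ b < nB ] 𝟙 ⌊ b ≟ b0 ⌋ + ∑[ b < nB ] (k * 𝟙 (not ⌊ b ≟ b0 ⌋))
      ≡⟨ cong₂ _+_ (∑-𝟙-≟ b0) (sym (*-distribˡ-sum k (λ b → 𝟙 (not ⌊ b ≟ b0 ⌋)))) ⟩
    1 + k * ∑[ b < nB ] 𝟙 (not ⌊ b ≟ b0 ⌋)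
      ∎
    where
    open ≡-Reasoning
    fiberSize-f : ∀ b → fiberSize f b ≡ 𝟙 ⌊ b ≟ b0 ⌋ + k * 𝟙 (not ⌊ b ≟ b0 ⌋)
    fiberSize-f b with b ≟ b0
    ... | yes refl  = trans fiber-b0 (cong suc (sym (*-zeroʳ k)))
    ... | no b≢b0 = trans (fiber-k b b≢b0) (sym (*-identityʳ k))

  imageSize-g*k≡n∸1 : imageSize g * k ≡ n ∸ 1
  imageSize-g*k≡n∸1 = begin
    imageSize g * k                          ≡⟨ cong (_* k) imageSize-g ⟩
    ∑[ b < nB ] 𝟙 (not ⌊ b ≟ b0 ⌋) * k      ≡⟨ *-comm _ k ⟩
    k * ∑[ b < nB ] 𝟙 (not ⌊ b ≟ b0 ⌋)      ≡⟨ cong (_∸ 1) n≡1+k*|B∖b0| ⟨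
    n ∸ 1                                    ∎
    where open ≡-Reasoning

  module Classes (maxS : MaxSIs GA g k) (m : ℕ) (c : Fin m → Fin nB) (c-injective : ∀ i j → c i ≡ c j → i ≡ j)
    (c-image : ∀ i → ∃ λ x → g x ≡ c i) (covers : ∀ x → ∃ λ i → g x ≡ c i) where

    open Partition g c c-injective covers

    c≢b0 : ∀ i → c i ≢ b0
    c≢b0 i ci≡b0 with c-image i
    ... | x , gx≡ci = g≢b0 x (trans gx≡ci ci≡b0)

    n≡1+m*k : n ≡ suc (m * k)
    n≡1+m*k = begin
      n                                            ≡⟨ ∑-fiberSize ⟨
      ∑[ i < m ] fiberSize g (c i)                 ≡⟨ sum-cong-≗ fiberSize-g ⟩
      ∑[ i < m ] (k + 𝟙 ⌊ f a ≟ c i ⌋)             ≡⟨ ∑-distrib-+ (λ _ → k) (λ i → 𝟙 ⌊ f a ≟ c i ⌋) ⟩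
      ∑[ i < m ] k + ∑[ i < m ] 𝟙 ⌊ f a ≟ c i ⌋   ≡⟨ cong₂ _+_ (∑-const m k) ∑-class-a ⟩
      m * k + 1                                    ≡⟨ +-comm (m * k) 1 ⟩
      suc (m * k)                                  ∎
      where
      open ≡-Reasoning
      fiberSize-g : ∀ i → fiberSize g (c i) ≡ k + 𝟙 ⌊ f a ≟ c i ⌋
      fiberSize-g i = trans (fiberSize-gFun f a0 a (c i) (λ fa0≡ci → c≢b0 i (trans (sym fa0≡ci) fa0≡b0)))
                            (cong (_+ 𝟙 ⌊ f a ≟ c i ⌋) (fiber-k (c i) (c≢b0 i)))
      ∑-class-a : ∑[ i < m ] 𝟙 ⌊ f a ≟ c i ⌋ ≡ 1
      ∑-class-a = trans (sum-cong-≗ λ i → cong (λ b → 𝟙 ⌊ b ≟ c i ⌋) (sym (gFun-≢ f a0 a a≢a0))) (∑-D a)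

    lam≤k : ∀ δ → δ ≢ 0# → lam GA g δ ≤ k
    lam≤k δ δ≢0 = proj₂ maxS _ (δ , δ≢0 , refl)

    2≤m : 2 ≤ m
    2≤m = m≢1⇒2≤m (class a) m≢1
      where
      m≢1 : m ≢ 1
      m≢1 m≡1 with proj₁ maxS
      ... | α , _ , lamα≡k = m≢1+m+n k (begin
        k               ≡⟨ lamα≡k ⟨
        lam GA g α      ≡⟨ lam-constant GA g g-constant α ⟩
        n               ≡⟨ n≡1+m*k ⟩
        suc (m * k)     ≡⟨ cong (λ t → suc (t * k)) m≡1 ⟩
        suc (k + 0)     ∎)
        where
        open ≡-Reasoning
        g-constant : ∀ x y → g x ≡ g y
        g-constant x y = Equivalence.to class≡⇔ (Fin1-trivial m≡1 (class x) (class y))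

    diffCount≡n∸lam : ∀ δ → diffCount GA D δ ≡ n ∸ lam GA g δ
    diffCount≡n∸lam δ =
      trans (sym (m+n∸n≡m (diffCount GA D δ) (lam GA g δ))) (cong (_∸ lam GA g δ) (diffCount+lam≡n GA δ))

    isDSS : IsDSS GA D (n ∸ k)
    isDSS = D-disjoint , λ δ δ≢0 →
      subst (n ∸ k ≤_) (sym (diffCount≡n∸lam δ)) (∸-monoʳ-≤ n (lam≤k δ δ≢0))

    isOptimalDSS : IsOptimalDSS GA D (n ∸ k)
    isOptimalDSS = isDSS ,
      subst (λ τ → ∃ λ c → IsCeilDiv ((n ∸ k) * (n ∸ 1)) (m ∸ 1) c × IsSQUARE ((n ∸ k) * (n ∸ 1) + c) (τ * τ))
            (sym tau≡n) (optimal-parameters k m 2≤m n≡1+m*k)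

    isPerfectDSS : ZDB GA g → IsPerfectDSS GA D (n ∸ k)
    isPerfectDSS (s , S≡s) = D-disjoint , λ δ δ≢0 → begin
      diffCount GA D δ  ≡⟨ diffCount≡n∸lam δ ⟩
      n ∸ lam GA g δ    ≡⟨ cong (n ∸_) (S≡s _ (δ , δ≢0 , refl)) ⟩
      n ∸ s             ≡⟨ cong (n ∸_) (S≡s k (proj₁ maxS)) ⟨
      n ∸ k             ∎
      where open ≡-Reasoning

theorem8 : ∀ {n nB : ℕ} (GA : FinAbGroup n) (GB : FinAbGroup nB) (k : ℕ) → 2 ≤ k →
    (f : Fin n → Fin nB) → Surjective f → ZDB GA f →
    (b0 : Fin nB) → fiberSize f b0 ≡ 1 → (∀ b → b ≢ b0 → fiberSize f b ≡ k) →
    (a0 : Fin n) → f a0 ≡ b0 → (a : Fin n) → f a0 ≢ f a →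
    (imageSize (gFun f a0 a) * k ≡ n ∸ 1) ×
    (MaxSIs GA (gFun f a0 a) k →
      ∀ (m : ℕ) (c : Fin m → Fin nB) →
      (∀ i j → c i ≡ c j → i ≡ j) →
      (∀ i → ∃ λ x → gFun f a0 a x ≡ c i) →
      (∀ x → ∃ λ i → gFun f a0 a x ≡ c i) →
      IsOptimalDSS GA (λ i x → ⌊ gFun f a0 a x ≟ c i ⌋) (n ∸ k) ×
      (ZDB GA (gFun f a0 a) → IsPerfectDSS GA (λ i x → ⌊ gFun f a0 a x ≟ c i ⌋) (n ∸ k)))
theorem8 GA _ k 2≤k f f-surjective _ b0 fiber-b0 fiber-k a0 fa0≡b0 a fa0≢fa =
  imageSize-g*k≡n∸1 ,
  λ maxS m c c-injective c-image covers →
    let open Classes maxS m c c-injective c-image covers in isOptimalDSS , isPerfectDSS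
  where
  instance
    k≢0 : NonZero k
    k≢0 = >-nonZero (<-trans z<s 2≤k)
  open ModifiedFunction GA k f f-surjective b0 fiber-b0 fiber-k a0 fa0≡b0 a fa0≢fa
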